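{- Let $G$ and $H$ be two connected nontrivial graphs. If $S$ is a hull set of $G\Box H$, then $\pi_G(S)$ and $\pi_H(S)$ are hull sets of $G$ and $H$ respectively.
   Context: All graphs are finite, simple and undirected. Cycle convexity on a graph $G$: for $S\subseteq V(G)$, the cycle interval $\langle S\rangle$ is $S$ together with every vertex $w\in V(G)$ that lies on a cycle of the induced subgraph $G[S\cup\{w\}]$ passing through $w$. $S$ is (cycle) convex if $\langle S\rangle=S$. The cycle convex hull $\langle S\rangle_C$ is the smallest convex set containing $S$; $S$ is a hull set of $G$ if $\langle S\rangle_C=V(G)$. The Cartesian product $G\Box H$ has vertex set $V(G)\times V(H)$, with $(g_1,h_1)\sim(g_2,h_2)$ iff ($g_1\sim g_2$ and $h_1=h_2$) or ($g_1=g_2$ and $h_1\sim h_2$). For $S\subseteq V(G\Box H)$, $\pi_G(S)=\{g:(g,h)\in S\text{ for some }h\}$ and $\pi_H(S)=\{h:(g,h)\in S\text{ for some }g\}$. A graph is nontrivial if it has at least two vertices. -}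

module Defs where

open import Level using (0ℓ)
open import Data.Nat using (ℕ; zero; suc; _+_; _*_; _≤_)
open import Data.Fin using (Fin; zero; suc; inject₁; fromℕ)
open import Data.Fin.Properties using (*↔×)
open import Data.Product using (Σ; ∃; ∃-syntax; _×_; _,_; proj₁; proj₂)
open import Data.Product.Function.NonDependent.Propositional using (_×-↔_)
open import Data.Sum using (_⊎_; inj₁; inj₂)
open import Data.Empty using (⊥)
open import Relation.Nullary using (¬_)
open import Relation.Binary.PropositionalEquality using (_≡_)
open import Relation.Unary using (Pred)
open import Function.Bundles using (_↔_)
open import Function.Definitions using (Injective)
open import Function.Properties.Inverse using (↔-trans; ↔-sym)

record Graph : Set₁ where
  field
    V       : Set
    size    : ℕ
    finite  : V ↔ Fin size
    Adj     : V → V → Set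
    Adj-sym : ∀ {u v} → Adj u v → Adj v u
    Adj-irr : ∀ {v} → ¬ Adj v v
open Graph public

VSet : Graph → Set₁
VSet G = Pred (V G) 0ℓ

Nontrivial : Graph → Set
Nontrivial G = 2 ≤ size G

data Walk (G : Graph) : V G → V G → Set where
  [] : ∀ {v} → Walk G v v
  _∷_ : ∀ {u v w} → Adj G u v → Walk G v w → Walk G u w

Connected : Graph → Set
Connected G = ∀ (u v : V G) → Walk G u v

-- A cycle of the induced subgraph G[S ∪ {w}] passing through w:
-- distinct vertices c 0, …, c (k-1) with k = 3 + len ≥ 3, c 0 = w,
-- consecutive vertices adjacent, c (k-1) adjacent to c 0,
-- all vertices in S ∪ {w}.
record CycleThrough (G : Graph) (S : VSet G) (w : V G) : Set where
  field
    len     : ℕ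
    c       : Fin (3 + len) → V G
    inj     : Injective _≡_ _≡_ c
    start   : c zero ≡ w
    step    : ∀ (i : Fin (2 + len)) → Adj G (c (inject₁ i)) (c (suc i))
    closing : Adj G (c (fromℕ (2 + len))) (c zero)
    inSet   : ∀ i → S (c i) ⊎ c i ≡ w

Interval : (G : Graph) → VSet G → VSet G
Interval G S w = S w ⊎ CycleThrough G S w

_⊆_ : ∀ {G : Graph} → VSet G → VSet G → Set
_⊆_ {G} S T = ∀ (v : V G) → S v → T v

-- S is convex iff ⟨S⟩ = S (i.e. ⟨S⟩ ⊆ S, the other inclusion being trivial).
Convex : (G : Graph) → VSet G → Set
Convex G S = _⊆_ {G} (Interval G S) S × _⊆_ {G} S (Interval G S)

Hull : (G : Graph) → VSet G → Pred (V G) (Level.suc 0ℓ)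
Hull G S v = ∀ (T : VSet G) → _⊆_ {G} S T → Convex G T → T v

IsHullSet : (G : Graph) → VSet G → Set₁
IsHullSet G S = ∀ (v : V G) → Hull G S v

data ProdAdj (G H : Graph) : (V G × V H) → (V G × V H) → Set where
  left  : ∀ {g₁ g₂ h} → Adj G g₁ g₂ → ProdAdj G H (g₁ , h) (g₂ , h)
  right : ∀ {g h₁ h₂} → Adj H h₁ h₂ → ProdAdj G H (g , h₁) (g , h₂)

_□_ : Graph → Graph → Graph
G □ H = record
  { V = V G × V H
  ; size = size G * size H
  ; finite = ↔-trans (finite G ×-↔ finite H) (↔-sym (*↔× {size G} {size H}))
  ; Adj = ProdAdj G H
  ; Adj-sym = λ { (left a) → left (Adj-sym G a) ; (right a) → right (Adj-sym H a) }
  ; Adj-irr = λ { (left a) → Adj-irr G a ; (right a) → Adj-irr H a }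
  }

πG : (G H : Graph) → VSet (G □ H) → VSet G
πG G H S g = ∃[ h ] S (g , h)

πH : (G H : Graph) → VSet (G □ H) → VSet H
πH G H S h = ∃[ g ] S (g , h)

{-# OPTIONS --safe #-}
module Submission where

-- If T is cycle convex in G, so is its preimage T × V(H) in G □ H. Take a cycle of G □ H
-- through (g, h) whose other vertices lie over T. If a cycle edge at (g, h) is an H-edge,
-- that neighbour lies over g and g ∈ T. Otherwise the two neighbours are (a, h) and (b, h)
-- with a ≠ b both adjacent to g, and projecting the rest of the cycle to G gives a walk
-- from a to b inside T. Erasing its loops leaves a path that either passes through g or
-- closes up with g into a cycle of G[T ∪ {g}]; either way g ∈ T. So every convex set
-- containing π_G(S) pulls back to a convex set containing S, hence is everything.

open import Defs
open import Data.Empty using (⊥-elim)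
open import Data.Fin as Fin using (Fin; zero; suc; inject₁; fromℕ; fromℕ<)
open import Data.List using (List; []; _∷_; length; lookup)
open import Data.List.Membership.Propositional using (_∈_; _∉_)
open import Data.List.Membership.Propositional.Properties using (∈-lookup)
open import Data.List.Relation.Unary.All as All using (All; []; _∷_)
open import Data.List.Relation.Unary.All.Properties using (¬Any⇒All¬)
open import Data.List.Relation.Unary.Any using (here; there)
open import Data.List.Relation.Unary.AllPairs using ([]; _∷_)
open import Data.List.Relation.Unary.Unique.Propositional using (Unique)
open import Data.Nat using (zero; suc; _+_)
open import Data.Product using (Σ; ∃; _×_; _,_; proj₁; proj₂)
open import Data.Sum using (_⊎_; inj₁; inj₂; [_,_]′)
open import Function using (_∘_; id)
open import Function.Bundles using (Inverse)
open import Function.Properties.Inverse using (↔⇒↣)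
open import Relation.Binary.Definitions using (DecidableEquality)
open import Relation.Binary.PropositionalEquality using (_≡_; _≢_; refl; sym; trans; cong; subst)
open import Relation.Nullary using (yes; no)
open import Relation.Nullary.Decidable using (via-injection)

lookup-injective : ∀ {a} {A : Set a} {xs : List A} → Unique xs →
                   ∀ {i j} → lookup xs i ≡ lookup xs j → i ≡ j
lookup-injective (_ ∷ _)      {zero}  {zero}  _  = refl
lookup-injective (x∉xs ∷ _)   {zero}  {suc j} eq = ⊥-elim (All.lookup x∉xs (∈-lookup j) eq)
lookup-injective (x∉xs ∷ _)   {suc i} {zero}  eq = ⊥-elim (All.lookup x∉xs (∈-lookup i) (sym eq))
lookup-injective (_ ∷ unique) {suc i} {suc j} eq = cong suc (lookup-injective unique eq)

vertex-≟ : (G : Graph) → DecidableEquality (V G)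
vertex-≟ G = via-injection (↔⇒↣ (finite G)) Fin._≟_

cycle-vertex-∈ : ∀ {G S w} (C : CycleThrough G S w) → ∀ i → i ≢ zero → S (CycleThrough.c C i)
cycle-vertex-∈ C i i≢0 = [ id , (λ ci≡w → ⊥-elim (i≢0 (inj (trans ci≡w (sym start))))) ]′ (inSet i)
  where open CycleThrough C

module _ {G : Graph} where

  open import Data.List.Membership.DecPropositional (vertex-≟ G) using (_∈?_)

  successors : ∀ {a b} → Walk G a b → List (V G)
  successors []                = []
  successors (_∷_ {v = v} _ w) = v ∷ successors w

  -- Defined through successors so that vertices w is a cons cell for every w: then
  -- lookup (vertices w) is indexed by Fin (suc (length (successors w))) on the nose.
  vertices : ∀ {a b} → Walk G a b → List (V G)
  vertices {a} w = a ∷ successors w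

  lookup-last : ∀ {a b} (w : Walk G a b) → lookup (vertices w) (fromℕ (length (successors w))) ≡ b
  lookup-last []      = refl
  lookup-last (_ ∷ w) = lookup-last w

  lookup-adjacent : ∀ {a b} (w : Walk G a b) (i : Fin (length (successors w))) →
                    Adj G (lookup (vertices w) (inject₁ i)) (lookup (vertices w) (suc i))
  lookup-adjacent (e ∷ _) zero    = e
  lookup-adjacent (_ ∷ w) (suc i) = lookup-adjacent w i

  record Path (P : VSet G) (a b : V G) : Set where
    constructor path
    field
      walk   : Walk G a b
      unique : Unique (vertices walk)
      within : All P (vertices walk)
  open Path

  dropUntil : ∀ {P a b x} (p : Path P a b) → x ∈ vertices (walk p) → Path P x b
  dropUntil p (here refl) = p
  dropUntil (path (_ ∷ w) (_ ∷ unique) (_ ∷ within)) (there x∈w) =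
    dropUntil (path w unique within) x∈w

  loopErase : ∀ {P a b} (w : Walk G a b) → All P (vertices w) → Path P a b
  loopErase []                Pw        = path [] ([] ∷ []) Pw
  loopErase {a = a} (e ∷ w) (Pa ∷ Pw) with loopErase w Pw
  ... | p with a ∈? vertices (walk p)
  ...   | yes a∈p = dropUntil p a∈p
  ...   | no  a∉p = path (e ∷ walk p) (¬Any⇒All¬ _ a∉p ∷ unique p) (Pa ∷ within p)

  removeStutters : ∀ {P : VSet G} n (f : Fin (suc n) → V G) →
                   (∀ i → Adj G (f (inject₁ i)) (f (suc i)) ⊎ f (inject₁ i) ≡ f (suc i)) →
                   (∀ i → P (f i)) → Σ (Walk G (f zero) (f (fromℕ n))) (All P ∘ vertices)
  removeStutters zero    f _     Pf = [] , Pf zero ∷ []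
  removeStutters (suc n) f steps Pf with removeStutters n (f ∘ suc) (steps ∘ suc) (Pf ∘ suc) | steps zero
  ... | w , Pw | inj₁ e  = e ∷ w , Pf zero ∷ Pw
  ... | w , Pw | inj₂ eq rewrite eq = w , Pw

  path⇒cycle : ∀ {T g a b} (p : Path T a b) → g ∉ vertices (walk p) → a ≢ b →
               Adj G g a → Adj G g b → CycleThrough G T g
  path⇒cycle (path [] _ _) _ a≢b _ _ = ⊥-elim (a≢b refl)
  path⇒cycle {g = g} (path W@(e ∷ w) unique within) g∉W _ ga gb = record
    { len     = length (successors w)
    ; c       = lookup (g ∷ vertices W)
    ; inj     = lookup-injective (¬Any⇒All¬ _ g∉W ∷ unique)
    ; start   = refl
    ; step    = λ { zero → ga ; (suc i) → lookup-adjacent W i }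
    ; closing = Adj-sym G (subst (Adj G g) (sym (lookup-last W)) gb)
    ; inSet   = λ { zero → inj₂ refl ; (suc i) → inj₁ (All.lookup within (∈-lookup i)) }
    }

  ∈-of-joined-neighbours : ∀ {T g a b} → Convex G T → Adj G g a → Adj G g b → a ≢ b →
                           (w : Walk G a b) → All T (vertices w) → T g
  ∈-of-joined-neighbours {g = g} (closed , _) ga gb a≢b w Tw with loopErase w Tw
  ... | p with g ∈? vertices (walk p)
  ...   | yes g∈p = All.lookup (within p) g∈p
  ...   | no  g∉p = closed g (inj₂ (path⇒cycle p g∉p a≢b ga gb))

WeakHomomorphism : (K G : Graph) → (V K → V G) → Set
WeakHomomorphism K G φ = ∀ {x y} → Adj K x y → Adj G (φ x) (φ y) ⊎ φ x ≡ φ y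

InjectiveOnPreservedEdges : (K G : Graph) → (V K → V G) → Set
InjectiveOnPreservedEdges K G φ = ∀ {w x y} → Adj K w x → Adj K w y →
  Adj G (φ w) (φ x) → Adj G (φ w) (φ y) → φ x ≡ φ y → x ≡ y

module _ {K G : Graph} {φ : V K → V G}
         (weakHom : WeakHomomorphism K G φ) (injective : InjectiveOnPreservedEdges K G φ) where

  cycle-preimage : ∀ {T w} → Convex G T → CycleThrough K (T ∘ φ) w → T (φ w)
  cycle-preimage {T} convex C = subst (T ∘ φ) start (from-ends (weakHom (step zero)) (weakHom closing))
    where
      open CycleThrough C
      first last : Fin (3 + len)
      first = suc zero
      last  = fromℕ (2 + len)

      arc : Σ (Walk G (φ (c first)) (φ (c last))) (All T ∘ vertices)
      arc = removeStutters (suc len) (φ ∘ c ∘ suc) (weakHom ∘ step ∘ suc) (λ i → cycle-vertex-∈ C (suc i) λ ())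

      from-ends : Adj G (φ (c zero)) (φ (c first)) ⊎ φ (c zero) ≡ φ (c first) →
                  Adj G (φ (c last)) (φ (c zero)) ⊎ φ (c last) ≡ φ (c zero) →
                  T (φ (c zero))
      from-ends (inj₂ eq) _         = subst T (sym eq) (cycle-vertex-∈ C first λ ())
      from-ends _         (inj₂ eq) = subst T eq (cycle-vertex-∈ C last λ ())
      from-ends (inj₁ e₁) (inj₁ eₗ) =
        ∈-of-joined-neighbours convex e₁ (Adj-sym G eₗ) distinct (proj₁ arc) (proj₂ arc)
        where
          distinct : φ (c first) ≢ φ (c last)
          distinct eq with inj (injective (step zero) (Adj-sym K closing) e₁ (Adj-sym G eₗ) eq)
          ... | ()

  convex-preimage : ∀ {T} → Convex G T → Convex K (T ∘ φ)
  convex-preimage convex = (λ { _ (inj₁ Tφw) → Tφw ; _ (inj₂ C) → cycle-preimage convex C })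
                         , (λ _ → inj₁)

  hullSet-image : (∀ g → ∃ λ x → φ x ≡ g) → ∀ {S A} → (∀ x → S x → A (φ x)) →
                  IsHullSet K S → IsHullSet G A
  hullSet-image surjective S⇒A hullSet g T A⊆T convex with surjective g
  ... | x , refl = hullSet x (T ∘ φ) (λ y Sy → A⊆T (φ y) (S⇒A y Sy)) (convex-preimage convex)

module _ (G H : Graph) where

  proj₁-weakHomomorphism : WeakHomomorphism (G □ H) G proj₁
  proj₁-weakHomomorphism (left e)  = inj₁ e
  proj₁-weakHomomorphism (right _) = inj₂ refl

  proj₂-weakHomomorphism : WeakHomomorphism (G □ H) H proj₂
  proj₂-weakHomomorphism (left _)  = inj₂ refl
  proj₂-weakHomomorphism (right e) = inj₁ e

  proj₁-injectiveOnPreservedEdges : InjectiveOnPreservedEdges (G □ H) G proj₁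
  proj₁-injectiveOnPreservedEdges (left _)  (left _)  _ _ refl = refl
  proj₁-injectiveOnPreservedEdges (right _) _         e _ _    = ⊥-elim (Adj-irr G e)
  proj₁-injectiveOnPreservedEdges _         (right _) _ e _    = ⊥-elim (Adj-irr G e)

  proj₂-injectiveOnPreservedEdges : InjectiveOnPreservedEdges (G □ H) H proj₂
  proj₂-injectiveOnPreservedEdges (right _) (right _) _ _ refl = refl
  proj₂-injectiveOnPreservedEdges (left _)  _         e _ _    = ⊥-elim (Adj-irr H e)
  proj₂-injectiveOnPreservedEdges _         (left _)  _ e _    = ⊥-elim (Adj-irr H e)

-- Nontrivial G unfolds to 1 < size G, so the vertex numbered 1 exists.
someVertex : (G : Graph) → Nontrivial G → V G
someVertex G nontrivial = Inverse.from (finite G) (fromℕ< nontrivial)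

mainTheorem13 : (G H : Graph) → Connected G → Connected H → Nontrivial G → Nontrivial H →
                  (S : VSet (G □ H)) → IsHullSet (G □ H) S →
                  IsHullSet G (πG G H S) × IsHullSet H (πH G H S)
mainTheorem13 G H _ _ ntG ntH S hullSet =
    hullSet-image (proj₁-weakHomomorphism G H) (proj₁-injectiveOnPreservedEdges G H)
      (λ g → (g , someVertex H ntH) , refl) (λ (_ , h) S[g,h] → h , S[g,h]) hullSet
  , hullSet-image (proj₂-weakHomomorphism G H) (proj₂-injectiveOnPreservedEdges G H)
      (λ h → (someVertex G ntG , h) , refl) (λ (g , _) S[g,h] → g , S[g,h]) hullSet
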